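{- $t(4,4)=8$.
   Context: A hypergraph is intersecting if every two of its edges intersect. $\tau(H)$ is the minimum size of a vertex set meeting every edge of $H$. Given a vector $\vec{a}=(a_1,\ldots,a_p)$ of positive integers with $\sum a_i=r$, an $r$-uniform hypergraph $H$ is $\vec{a}$-partitioned if $V(H)=\bigcup_{i\le p}V_i$ with the $V_i$ pairwise disjoint and $|e\cap V_i|=a_i$ for all edges $e$ and all $i$. $t(a_1,\ldots,a_p)$ is the maximum of $\tau(H)$ over all finite intersecting $\vec{a}$-partitioned $r$-uniform hypergraphs $H$. -}

module Defs where

open import Data.Nat using (ℕ; _≤_)
open import Data.Bool using (Bool)
open import Data.Fin using (Fin; _≟_)
open import Data.Fin.Subset using (Subset; _∩_; _∈_; ∣_∣; Nonempty)
open import Data.Vec using (Vec; lookup; tabulate; sum)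
open import Data.List using (List)
import Data.List.Membership.Propositional as L
open import Data.Product using (Σ; _×_)
open import Relation.Nullary.Decidable using (⌊_⌋)

Hypergraph : ℕ → Set
Hypergraph n = List (Subset n)

-- The part V_i of a partition of Fin n given by a colouring part : Fin n → Fin p.
Part : ∀ {n p} → (Fin n → Fin p) → Fin p → Subset n
Part part i = tabulate (λ v → ⌊ part v ≟ i ⌋)

Uniform : ∀ {n} → ℕ → Hypergraph n → Set
Uniform r E = ∀ {e} → e L.∈ E → ∣ e ∣ ≡ r
  where open import Relation.Binary.PropositionalEquality using (_≡_)

Partitioned : ∀ {n p} → Vec ℕ p → (Fin n → Fin p) → Hypergraph n → Set
Partitioned a part E = ∀ {e} → e L.∈ E → ∀ i → ∣ e ∩ Part part i ∣ ≡ lookup a i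
  where open import Relation.Binary.PropositionalEquality using (_≡_)

Intersecting : ∀ {n} → Hypergraph n → Set
Intersecting E = ∀ {e f} → e L.∈ E → f L.∈ E → Nonempty (e ∩ f)

Cover : ∀ {n} → Hypergraph n → Subset n → Set
Cover E T = ∀ {e} → e L.∈ E → Nonempty (e ∩ T)

IsTau : ∀ {n} → Hypergraph n → ℕ → Set
IsTau E k = (Σ (Subset _) λ T → Cover E T × ∣ T ∣ ≡ k)
          × (∀ T → Cover E T → k ≤ ∣ T ∣)
  where open import Relation.Binary.PropositionalEquality using (_≡_)

Admissible : ∀ {n p} → Vec ℕ p → (Fin n → Fin p) → Hypergraph n → Set
Admissible a part E = Uniform (sum a) E × Partitioned a part E × Intersecting E

IsT : ∀ {p} → Vec ℕ p → ℕ → Set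
IsT {p} a m =
    (∀ n (part : Fin n → Fin p) (E : Hypergraph n) → Admissible a part E →
       ∀ k → IsTau E k → k ≤ m)
  × (Σ ℕ λ n → Σ (Fin n → Fin p) λ part → Σ (Hypergraph n) λ E →
       Admissible a part E × IsTau E m)

module Submission where

-- In an intersecting hypergraph every edge meets every edge, so
-- each edge is itself a cover; hence τ(H) ≤ r for every intersecting
-- r-uniform H (τ = 0 if H has no edges).  This gives t(4,4) ≤ 8 without
-- using the partition.
--
-- We exhibit an intersecting (4,4)-partitioned 8-uniform
-- hypergraph on 36 vertices with 100 edges and τ = 8.  Its admissibility is
-- decided by evaluation.  That no 7 vertices cover it is certified by a
-- branch-and-bound search `noCoverWithin`, proved sound once and for all:
-- pick a vertex v of a smallest edge; a cover T either contains v (and then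
-- T - v covers the edges avoiding v) or avoids v (and then T covers every
-- edge with v deleted).  For speed the search runs on edges written as lists
-- of vertex numbers; `vertexSet` turns such a list into a subset of Fin n.

open import Defs
open import Data.Bool using (Bool; true; false; _∧_; if_then_else_)
open import Data.Bool.Properties using (∧-conicalˡ; ∧-conicalʳ)
open import Data.Fin using (Fin; toℕ) renaming (zero to fzero; suc to fsuc)
open import Data.Fin.Subset using (Subset; _∩_; _∈_; _-_; ∣_∣; Nonempty; ⊥)
open import Data.Fin.Subset.Properties
  using (_∈?_; nonempty?; x∈p∩q⁻; x∈p∧x≢y⇒x∈p-y; x∈p⇒∣p-x∣<∣p∣; ∣⊥∣≡0)
import Data.Fin.Properties as Fin
open import Data.List using (List; []; _∷_; map; filter; length)
open import Data.List.Extrema.Nat using (argmin; argmin-all)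
open import Data.List.Membership.Propositional using () renaming (_∈_ to _∈ₗ_)
open import Data.List.Membership.Propositional.Properties
  using (∈-map⁺; ∈-map⁻; ∈-filter⁺; ∈-filter⁻)
open import Data.List.Relation.Unary.All as All using ()
open import Data.List.Relation.Unary.Any using (here; there)
open import Data.Nat using (ℕ; zero; suc; _≤_; _<_; z≤n; s≤s)
import Data.Nat.Properties as ℕ
open import Data.List.Membership.DecPropositional ℕ._≟_ using () renaming (_∈?_ to _∈ₗ?_)
open import Data.Product using (Σ; _×_; _,_; proj₁; proj₂)
open import Data.Vec using (Vec; _∷_; []; tabulate; sum; lookup)
open import Data.Vec.Properties using (lookup∘tabulate; []=⇒lookup)
open import Relation.Nullary using (Dec; yes; no; ¬?; does; _×-dec_)
open import Relation.Nullary.Decidable using (from-yes; map′)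
open import Relation.Unary using (Decidable)
open import Relation.Binary.PropositionalEquality using (_≡_; _≢_; refl; subst; trans; sym)

private
  variable
    n : ℕ

edge-covers : {E : Hypergraph n} {e : Subset n} → Intersecting E → e ∈ₗ E → Cover E e
edge-covers intersecting e∈E f∈E = intersecting f∈E e∈E

τ≤uniformity : ∀ {r k} {E : Hypergraph n} →
               Uniform r E → Intersecting E → IsTau E k → k ≤ r
τ≤uniformity {n = n} {E = []} _ _ (_ , minimal) =
  ℕ.≤-trans (subst (_ ≤_) (∣⊥∣≡0 n) (minimal ⊥ (λ ()))) z≤n
τ≤uniformity {E = e ∷ E} uniform intersecting (_ , minimal) =
  subst (_ ≤_) (uniform (here refl)) (minimal e (edge-covers intersecting (here refl)))

nonempty⇒size>0 : {T : Subset n} → Nonempty T → 0 < ∣ T ∣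
nonempty⇒size>0 (x , x∈T) = ℕ.≤-<-trans z≤n (x∈p⇒∣p-x∣<∣p∣ x∈T)

EdgeList : Set
EdgeList = List ℕ

Meets : Subset n → EdgeList → Set
Meets T l = Σ (Fin _) λ x → toℕ x ∈ₗ l × x ∈ T

Covers : Subset n → List EdgeList → Set
Covers T Ls = ∀ {l} → l ∈ₗ Ls → Meets T l

edgesAvoiding : ℕ → List EdgeList → List EdgeList
edgesAvoiding v = filter (λ l → ¬? (v ∈ₗ? l))

deleteVertex : ℕ → List EdgeList → List EdgeList
deleteVertex v = map (filter (λ w → ¬? (v ℕ.≟ w)))

covers-edgesAvoiding : ∀ {Ls} {T : Subset n} {x} →
                       Covers T Ls → Covers (T - x) (edgesAvoiding (toℕ x) Ls)
covers-edgesAvoiding {Ls = Ls} {x = x} covers l∈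
  with ∈-filter⁻ (λ l → ¬? (toℕ x ∈ₗ? l)) {xs = Ls} l∈
... | l∈Ls , x∉l with covers l∈Ls
...   | y , y∈l , y∈T = y , y∈l , x∈p∧x≢y⇒x∈p-y y∈T (λ { refl → x∉l y∈l })

covers-deleteVertex : ∀ {Ls} {T : Subset n} {v} → (∀ {x} → x ∈ T → toℕ x ≢ v) →
                      Covers T Ls → Covers T (deleteVertex v Ls)
covers-deleteVertex {v = v} v∉T covers l-v∈
  with ∈-map⁻ (filter (λ w → ¬? (v ℕ.≟ w))) l-v∈
... | l , l∈Ls , refl with covers l∈Ls
...   | x , x∈l , x∈T =
  x , ∈-filter⁺ (λ w → ¬? (v ℕ.≟ w)) x∈l (λ v≡x → v∉T x∈T (sym v≡x)) , x∈T

-- Branch-and-bound search: `noCoverWithin fuel k Ls ≡ true` certifies that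
-- Ls has no cover with at most k vertices.  Branching on a vertex of a
-- smallest edge keeps the search tree small; the fuel bounds its depth.
noCoverWithin : ℕ → ℕ → List EdgeList → Bool
noCoverWithin zero k Ls = false
noCoverWithin (suc fuel) k [] = false
noCoverWithin (suc fuel) k (l ∷ Ls) with argmin length l Ls
... | [] = true
... | v ∷ _ with k
...   | zero = true
...   | suc k' = noCoverWithin fuel k' (edgesAvoiding v (l ∷ Ls))
                 ∧ noCoverWithin fuel (suc k') (deleteVertex v (l ∷ Ls))

-- T meets a smallest edge, so that edge is nonempty and, for k = 0, T is
-- nonempty.  Otherwise either some y ∈ T has number v, and the first
-- recursive certificate bounds T - y, or none has, and the second bounds T.
noCoverWithin-sound : ∀ fuel k (Ls : List EdgeList) → noCoverWithin fuel k Ls ≡ true →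
                      (T : Subset n) → Covers T Ls → k < ∣ T ∣
noCoverWithin-sound (suc fuel) k (l ∷ Ls) certified T covers
  with argmin length l Ls | smallest-met
  where
  smallest-met : Meets T (argmin length l Ls)
  smallest-met = argmin-all length (covers (here refl)) (All.tabulate (λ l∈ → covers (there l∈)))
... | [] | _ , () , _
... | v ∷ _ | x , _ , x∈T with k
...   | zero = nonempty⇒size>0 (x , x∈T)
...   | suc k' with Fin.any? (λ y → (toℕ y ℕ.≟ v) ×-dec (y ∈? T))
...     | yes (y , refl , y∈T) = ℕ.<-≤-trans (s≤s smaller) (x∈p⇒∣p-x∣<∣p∣ y∈T)
  where
  smaller : k' < ∣ T - y ∣
  smaller = noCoverWithin-sound fuel k' (edgesAvoiding (toℕ y) (l ∷ Ls))
              (∧-conicalˡ _ _ certified) (T - y) (covers-edgesAvoiding covers)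
...     | no v∉T = noCoverWithin-sound fuel (suc k') (deleteVertex v (l ∷ Ls))
                     (∧-conicalʳ _ _ certified) T
                     (covers-deleteVertex (λ y∈T y≡v → v∉T (_ , y≡v , y∈T)) covers)

vertexSet : EdgeList → Subset n
vertexSet l = tabulate (λ x → does (toℕ x ∈ₗ? l))

∈-vertexSet⁻ : ∀ {x : Fin n} l → x ∈ vertexSet l → toℕ x ∈ₗ l
∈-vertexSet⁻ {x = x} l x∈ =
  decided (toℕ x ∈ₗ? l) (trans (sym (lookup∘tabulate _ x)) ([]=⇒lookup x∈))
  where
  decided : (d : Dec (toℕ x ∈ₗ l)) → does d ≡ true → toℕ x ∈ₗ l
  decided (yes x∈l) _ = x∈l

cover⇒covers : ∀ {Ls} {T : Subset n} → Cover (map vertexSet Ls) T → Covers T Ls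
cover⇒covers {T = T} cover {l} l∈Ls with cover (∈-map⁺ vertexSet l∈Ls)
... | x , x∈l∩T with x∈p∩q⁻ (vertexSet l) T x∈l∩T
...   | x∈l , x∈T = x , ∈-vertexSet⁻ l x∈l , x∈T

isTau-by-search : ∀ {Ls} {T : Subset n} {k} fuel →
                  Cover (map vertexSet Ls) T → ∣ T ∣ ≡ suc k →
                  noCoverWithin fuel k Ls ≡ true → IsTau (map vertexSet Ls) (suc k)
isTau-by-search {Ls = Ls} {T} fuel cover size certified =
  (T , cover , size) ,
  λ T' cover' → noCoverWithin-sound fuel _ Ls certified T' (cover⇒covers cover')

all∈? : {A : Set} {P : A → Set} → Decidable P → (xs : List A) →
        Dec (∀ {x} → x ∈ₗ xs → P x)
all∈? P? xs = map′ All.lookup All.tabulate (All.all? P? xs)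

admissible? : ∀ {p} (a : Vec ℕ p) (part : Fin n → Fin p) (E : Hypergraph n) →
              Dec (Admissible a part E)
admissible? a part E =
  all∈? (λ e → ∣ e ∣ ℕ.≟ sum a) E
  ×-dec all∈? (λ e → Fin.all? (λ i → ∣ e ∩ Part part i ∣ ℕ.≟ lookup a i)) E
  ×-dec map′ (λ h {e} {f} e∈E f∈E → h e∈E f∈E) (λ h {e} e∈E {f} f∈E → h e∈E f∈E)
             (all∈? (λ e → all∈? (λ f → nonempty? (e ∩ f)) E) E)

exampleEdges : List EdgeList
exampleEdges =
  (21 ∷ 22 ∷ 23 ∷ 24 ∷ 25 ∷ 26 ∷ 27 ∷ 35 ∷ []) ∷
  (1 ∷ 2 ∷ 3 ∷ 8 ∷ 10 ∷ 15 ∷ 25 ∷ 33 ∷ []) ∷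
  (21 ∷ 22 ∷ 23 ∷ 24 ∷ 25 ∷ 26 ∷ 27 ∷ 32 ∷ []) ∷
  (10 ∷ 11 ∷ 12 ∷ 13 ∷ 14 ∷ 16 ∷ 23 ∷ 31 ∷ []) ∷
  (28 ∷ 29 ∷ 30 ∷ 31 ∷ 32 ∷ 33 ∷ 34 ∷ 35 ∷ []) ∷
  (0 ∷ 2 ∷ 3 ∷ 6 ∷ 11 ∷ 16 ∷ 22 ∷ 32 ∷ []) ∷
  (15 ∷ 16 ∷ 17 ∷ 18 ∷ 19 ∷ 20 ∷ 24 ∷ 35 ∷ []) ∷
  (10 ∷ 11 ∷ 12 ∷ 13 ∷ 14 ∷ 17 ∷ 23 ∷ 30 ∷ []) ∷
  (15 ∷ 16 ∷ 17 ∷ 18 ∷ 19 ∷ 20 ∷ 23 ∷ 34 ∷ []) ∷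
  (6 ∷ 7 ∷ 8 ∷ 9 ∷ 12 ∷ 17 ∷ 25 ∷ 30 ∷ []) ∷
  (6 ∷ 7 ∷ 8 ∷ 9 ∷ 13 ∷ 19 ∷ 24 ∷ 29 ∷ []) ∷
  (3 ∷ 4 ∷ 5 ∷ 6 ∷ 14 ∷ 16 ∷ 22 ∷ 29 ∷ []) ∷
  (6 ∷ 7 ∷ 8 ∷ 9 ∷ 11 ∷ 16 ∷ 22 ∷ 32 ∷ []) ∷
  (3 ∷ 4 ∷ 5 ∷ 6 ∷ 10 ∷ 19 ∷ 22 ∷ 31 ∷ []) ∷
  (3 ∷ 4 ∷ 5 ∷ 6 ∷ 13 ∷ 15 ∷ 24 ∷ 30 ∷ []) ∷
  (0 ∷ 1 ∷ 3 ∷ 7 ∷ 12 ∷ 17 ∷ 23 ∷ 32 ∷ []) ∷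
  (10 ∷ 11 ∷ 12 ∷ 13 ∷ 14 ∷ 17 ∷ 24 ∷ 28 ∷ []) ∷
  (3 ∷ 4 ∷ 5 ∷ 6 ∷ 12 ∷ 17 ∷ 22 ∷ 31 ∷ []) ∷
  (3 ∷ 4 ∷ 5 ∷ 6 ∷ 13 ∷ 15 ∷ 24 ∷ 31 ∷ []) ∷
  (0 ∷ 1 ∷ 5 ∷ 6 ∷ 13 ∷ 20 ∷ 24 ∷ 30 ∷ []) ∷
  (3 ∷ 4 ∷ 5 ∷ 6 ∷ 10 ∷ 19 ∷ 23 ∷ 29 ∷ []) ∷
  (3 ∷ 4 ∷ 5 ∷ 6 ∷ 12 ∷ 17 ∷ 21 ∷ 28 ∷ []) ∷
  (3 ∷ 4 ∷ 5 ∷ 7 ∷ 11 ∷ 15 ∷ 22 ∷ 31 ∷ []) ∷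
  (3 ∷ 4 ∷ 5 ∷ 7 ∷ 10 ∷ 15 ∷ 23 ∷ 33 ∷ []) ∷
  (3 ∷ 4 ∷ 5 ∷ 7 ∷ 14 ∷ 15 ∷ 21 ∷ 29 ∷ []) ∷
  (3 ∷ 4 ∷ 5 ∷ 9 ∷ 10 ∷ 16 ∷ 21 ∷ 30 ∷ []) ∷
  (3 ∷ 4 ∷ 5 ∷ 7 ∷ 10 ∷ 17 ∷ 22 ∷ 32 ∷ []) ∷
  (3 ∷ 4 ∷ 5 ∷ 7 ∷ 14 ∷ 16 ∷ 23 ∷ 29 ∷ []) ∷
  (3 ∷ 4 ∷ 5 ∷ 6 ∷ 12 ∷ 16 ∷ 21 ∷ 30 ∷ []) ∷
  (3 ∷ 4 ∷ 5 ∷ 7 ∷ 11 ∷ 17 ∷ 24 ∷ 28 ∷ []) ∷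
  (1 ∷ 2 ∷ 5 ∷ 8 ∷ 14 ∷ 20 ∷ 24 ∷ 29 ∷ []) ∷
  (0 ∷ 1 ∷ 3 ∷ 8 ∷ 10 ∷ 17 ∷ 21 ∷ 35 ∷ []) ∷
  (1 ∷ 2 ∷ 5 ∷ 9 ∷ 11 ∷ 16 ∷ 23 ∷ 32 ∷ []) ∷
  (1 ∷ 2 ∷ 5 ∷ 6 ∷ 14 ∷ 15 ∷ 27 ∷ 32 ∷ []) ∷
  (1 ∷ 2 ∷ 4 ∷ 7 ∷ 14 ∷ 20 ∷ 23 ∷ 34 ∷ []) ∷
  (1 ∷ 2 ∷ 5 ∷ 7 ∷ 14 ∷ 18 ∷ 21 ∷ 34 ∷ []) ∷
  (10 ∷ 11 ∷ 12 ∷ 13 ∷ 14 ∷ 16 ∷ 22 ∷ 29 ∷ []) ∷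
  (1 ∷ 2 ∷ 4 ∷ 7 ∷ 12 ∷ 17 ∷ 26 ∷ 32 ∷ []) ∷
  (1 ∷ 2 ∷ 5 ∷ 9 ∷ 11 ∷ 19 ∷ 24 ∷ 30 ∷ []) ∷
  (1 ∷ 2 ∷ 4 ∷ 9 ∷ 10 ∷ 19 ∷ 21 ∷ 35 ∷ []) ∷
  (1 ∷ 2 ∷ 5 ∷ 7 ∷ 13 ∷ 20 ∷ 26 ∷ 30 ∷ []) ∷
  (0 ∷ 1 ∷ 3 ∷ 8 ∷ 11 ∷ 16 ∷ 21 ∷ 31 ∷ []) ∷
  (1 ∷ 2 ∷ 5 ∷ 6 ∷ 14 ∷ 18 ∷ 25 ∷ 28 ∷ []) ∷
  (1 ∷ 2 ∷ 5 ∷ 8 ∷ 11 ∷ 18 ∷ 23 ∷ 30 ∷ []) ∷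
  (3 ∷ 4 ∷ 5 ∷ 7 ∷ 12 ∷ 16 ∷ 21 ∷ 30 ∷ []) ∷
  (1 ∷ 2 ∷ 5 ∷ 6 ∷ 14 ∷ 19 ∷ 27 ∷ 31 ∷ []) ∷
  (1 ∷ 2 ∷ 5 ∷ 7 ∷ 13 ∷ 17 ∷ 26 ∷ 35 ∷ []) ∷
  (1 ∷ 2 ∷ 4 ∷ 9 ∷ 11 ∷ 16 ∷ 27 ∷ 31 ∷ []) ∷
  (10 ∷ 11 ∷ 12 ∷ 13 ∷ 14 ∷ 17 ∷ 22 ∷ 29 ∷ []) ∷
  (1 ∷ 2 ∷ 5 ∷ 7 ∷ 11 ∷ 16 ∷ 25 ∷ 32 ∷ []) ∷
  (1 ∷ 2 ∷ 5 ∷ 6 ∷ 12 ∷ 18 ∷ 24 ∷ 35 ∷ []) ∷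
  (0 ∷ 1 ∷ 3 ∷ 7 ∷ 14 ∷ 15 ∷ 22 ∷ 35 ∷ []) ∷
  (1 ∷ 2 ∷ 4 ∷ 8 ∷ 11 ∷ 19 ∷ 24 ∷ 28 ∷ []) ∷
  (1 ∷ 2 ∷ 4 ∷ 6 ∷ 14 ∷ 17 ∷ 25 ∷ 34 ∷ []) ∷
  (1 ∷ 2 ∷ 4 ∷ 8 ∷ 13 ∷ 17 ∷ 27 ∷ 29 ∷ []) ∷
  (0 ∷ 2 ∷ 5 ∷ 9 ∷ 12 ∷ 16 ∷ 24 ∷ 31 ∷ []) ∷
  (1 ∷ 2 ∷ 4 ∷ 6 ∷ 13 ∷ 20 ∷ 25 ∷ 29 ∷ []) ∷
  (0 ∷ 2 ∷ 4 ∷ 8 ∷ 14 ∷ 16 ∷ 23 ∷ 31 ∷ []) ∷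
  (0 ∷ 2 ∷ 4 ∷ 6 ∷ 13 ∷ 16 ∷ 22 ∷ 34 ∷ []) ∷
  (10 ∷ 11 ∷ 12 ∷ 13 ∷ 14 ∷ 15 ∷ 21 ∷ 28 ∷ []) ∷
  (1 ∷ 2 ∷ 4 ∷ 8 ∷ 10 ∷ 20 ∷ 23 ∷ 33 ∷ []) ∷
  (0 ∷ 1 ∷ 4 ∷ 7 ∷ 14 ∷ 16 ∷ 27 ∷ 31 ∷ []) ∷
  (6 ∷ 7 ∷ 8 ∷ 9 ∷ 11 ∷ 15 ∷ 21 ∷ 32 ∷ []) ∷
  (0 ∷ 2 ∷ 3 ∷ 6 ∷ 12 ∷ 17 ∷ 27 ∷ 31 ∷ []) ∷
  (0 ∷ 2 ∷ 4 ∷ 6 ∷ 12 ∷ 18 ∷ 21 ∷ 30 ∷ []) ∷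
  (0 ∷ 2 ∷ 4 ∷ 6 ∷ 14 ∷ 17 ∷ 27 ∷ 29 ∷ []) ∷
  (0 ∷ 2 ∷ 4 ∷ 7 ∷ 11 ∷ 16 ∷ 25 ∷ 30 ∷ []) ∷
  (0 ∷ 2 ∷ 4 ∷ 9 ∷ 10 ∷ 18 ∷ 22 ∷ 28 ∷ []) ∷
  (0 ∷ 2 ∷ 4 ∷ 8 ∷ 10 ∷ 20 ∷ 23 ∷ 30 ∷ []) ∷
  (0 ∷ 2 ∷ 4 ∷ 8 ∷ 14 ∷ 16 ∷ 24 ∷ 29 ∷ []) ∷
  (0 ∷ 2 ∷ 3 ∷ 8 ∷ 10 ∷ 15 ∷ 27 ∷ 31 ∷ []) ∷
  (0 ∷ 2 ∷ 5 ∷ 7 ∷ 14 ∷ 20 ∷ 23 ∷ 28 ∷ []) ∷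
  (0 ∷ 2 ∷ 5 ∷ 7 ∷ 12 ∷ 19 ∷ 21 ∷ 31 ∷ []) ∷
  (0 ∷ 2 ∷ 3 ∷ 6 ∷ 10 ∷ 19 ∷ 26 ∷ 28 ∷ []) ∷
  (0 ∷ 1 ∷ 4 ∷ 8 ∷ 14 ∷ 15 ∷ 23 ∷ 31 ∷ []) ∷
  (0 ∷ 2 ∷ 3 ∷ 8 ∷ 13 ∷ 15 ∷ 22 ∷ 28 ∷ []) ∷
  (15 ∷ 16 ∷ 17 ∷ 18 ∷ 19 ∷ 20 ∷ 27 ∷ 29 ∷ []) ∷
  (0 ∷ 2 ∷ 5 ∷ 7 ∷ 10 ∷ 20 ∷ 21 ∷ 34 ∷ []) ∷
  (0 ∷ 1 ∷ 4 ∷ 6 ∷ 12 ∷ 17 ∷ 25 ∷ 31 ∷ []) ∷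
  (0 ∷ 2 ∷ 5 ∷ 7 ∷ 11 ∷ 17 ∷ 25 ∷ 30 ∷ []) ∷
  (0 ∷ 2 ∷ 4 ∷ 9 ∷ 13 ∷ 15 ∷ 23 ∷ 31 ∷ []) ∷
  (6 ∷ 7 ∷ 8 ∷ 9 ∷ 10 ∷ 19 ∷ 23 ∷ 35 ∷ []) ∷
  (0 ∷ 2 ∷ 5 ∷ 6 ∷ 13 ∷ 18 ∷ 22 ∷ 31 ∷ []) ∷
  (0 ∷ 1 ∷ 3 ∷ 7 ∷ 14 ∷ 17 ∷ 27 ∷ 29 ∷ []) ∷
  (0 ∷ 2 ∷ 3 ∷ 9 ∷ 11 ∷ 17 ∷ 24 ∷ 29 ∷ []) ∷
  (6 ∷ 7 ∷ 8 ∷ 9 ∷ 13 ∷ 15 ∷ 22 ∷ 35 ∷ []) ∷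
  (0 ∷ 2 ∷ 3 ∷ 9 ∷ 13 ∷ 16 ∷ 23 ∷ 30 ∷ []) ∷
  (0 ∷ 1 ∷ 4 ∷ 6 ∷ 13 ∷ 19 ∷ 23 ∷ 30 ∷ []) ∷
  (0 ∷ 1 ∷ 4 ∷ 6 ∷ 11 ∷ 16 ∷ 24 ∷ 33 ∷ []) ∷
  (6 ∷ 7 ∷ 8 ∷ 9 ∷ 10 ∷ 16 ∷ 27 ∷ 34 ∷ []) ∷
  (0 ∷ 1 ∷ 4 ∷ 9 ∷ 10 ∷ 18 ∷ 21 ∷ 28 ∷ []) ∷
  (0 ∷ 1 ∷ 5 ∷ 9 ∷ 14 ∷ 16 ∷ 22 ∷ 28 ∷ []) ∷
  (0 ∷ 1 ∷ 4 ∷ 9 ∷ 12 ∷ 17 ∷ 24 ∷ 30 ∷ []) ∷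
  (0 ∷ 1 ∷ 3 ∷ 6 ∷ 10 ∷ 15 ∷ 27 ∷ 35 ∷ []) ∷
  (0 ∷ 1 ∷ 3 ∷ 7 ∷ 11 ∷ 16 ∷ 23 ∷ 34 ∷ []) ∷
  (0 ∷ 1 ∷ 5 ∷ 8 ∷ 10 ∷ 19 ∷ 21 ∷ 29 ∷ []) ∷
  (0 ∷ 1 ∷ 4 ∷ 9 ∷ 12 ∷ 15 ∷ 23 ∷ 29 ∷ []) ∷
  (0 ∷ 1 ∷ 5 ∷ 8 ∷ 11 ∷ 15 ∷ 22 ∷ 28 ∷ []) ∷
  (0 ∷ 1 ∷ 5 ∷ 7 ∷ 13 ∷ 18 ∷ 22 ∷ 29 ∷ []) ∷
  (0 ∷ 1 ∷ 3 ∷ 9 ∷ 10 ∷ 18 ∷ 24 ∷ 28 ∷ []) ∷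
  (0 ∷ 1 ∷ 5 ∷ 9 ∷ 11 ∷ 16 ∷ 24 ∷ 30 ∷ []) ∷
  (0 ∷ 1 ∷ 5 ∷ 6 ∷ 11 ∷ 15 ∷ 21 ∷ 35 ∷ []) ∷ []

firstClass : List ℕ
firstClass =
  (1 ∷ 2 ∷ 6 ∷ 7 ∷ 10 ∷ 15 ∷ 16 ∷ 17 ∷ 21 ∷ 22 ∷ 23 ∷ 24 ∷ 28 ∷ 29 ∷ 30 ∷ 31 ∷ [])


example : Hypergraph 36
example = map vertexSet exampleEdges

examplePart : Fin 36 → Fin 2
examplePart x = if does (toℕ x ∈ₗ? firstClass) then fzero else fsuc fzero

example-admissible : Admissible (4 ∷ 4 ∷ []) examplePart example
example-admissible = from-yes (admissible? (4 ∷ 4 ∷ []) examplePart example)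

-- The first edge is a cover of size 8, and the search excludes covers of size 7.
example-τ : IsTau example 8
example-τ = isTau-by-search {Ls = exampleEdges} 50
              (edge-covers intersecting (here refl)) (uniform (here refl)) refl
  where
  uniform : Uniform 8 example
  uniform = proj₁ example-admissible
  intersecting : Intersecting example
  intersecting = proj₂ (proj₂ example-admissible)

corollary3p1 : IsT (4 ∷ 4 ∷ []) 8
corollary3p1 = upper , 36 , examplePart , example , example-admissible , example-τ
  where
  upper : ∀ n (part : Fin n → Fin 2) (E : Hypergraph n) → Admissible (4 ∷ 4 ∷ []) part E →
          ∀ k → IsTau E k → k ≤ 8
  upper _ _ _ (uniform , _ , intersecting) _ = τ≤uniformity uniform intersecting
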